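{- For every sequent $\Gamma\Rightarrow\delta$ of first-order arithmetic: if $\mathrm{HA}\vdash\Gamma\Rightarrow\delta$ then $\mathrm{CHA}\vdash\Gamma\Rightarrow\delta$.
   Context: Language: terms from variables, $0,S,+,\cdot$; formulas from $s=t,\bot,\wedge,\vee,\to,\forall,\exists$. Sequents $\Gamma\Rightarrow\delta$: finite set $\Gamma$, single formula $\delta$. $\mathrm{HA}$: sequent calculus (finite tree proofs) with the standard intuitionistic rules Ax ($\Gamma,\delta\Rightarrow\delta$), $\to$L/R, $\wedge$L/R, $\vee$L/R, $\forall$L/R, $\exists$L/R (usual eigenvariable conditions), $\bot$L, $=$L (from $\Gamma[x/y]\Rightarrow\delta[x/y]$ infer $\Gamma[s/x,t/y],s=t\Rightarrow\delta[s/x,t/y]$, $x,y\notin\mathrm{FV}(s,t)$), $=$R ($\Gamma\Rightarrow t=t$), weakening, cut, arithmetic axioms $\Rightarrow 0\neq St$, $Ss=St\Rightarrow s=t$, $\Rightarrow s+0=s$, $\Rightarrow s+St=S(s+t)$, $\Rightarrow s\cdot0=0$, $\Rightarrow s\cdot St=(s\cdot t)+s$, and induction axioms $\varphi(0),\forall x.\,\varphi(x)\to\varphi(Sx)\Rightarrow\varphi(s)$ for all formulas $\varphi$ and terms $s$. $\mathrm{CHA}$: rules of $\mathrm{HA}$ without induction axioms plus $\textsc{Case}_x$ (from $\Gamma[0/x]\Rightarrow\delta[0/x]$ and $\Gamma[Sx/x]\Rightarrow\delta[Sx/x]$ infer $\Gamma\Rightarrow\delta$). A pre-proof is a finite tree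 with a partial map $\beta$ sending some leaves (buds) to inner nodes (companions); non-bud nodes carry rule instances whose premises label the children; buds carry their companion's sequent. An infinite branch starts at the root and each step goes to a child or from a bud to its companion. A $\mathrm{CHA}$-proof is a pre-proof such that along every infinite branch some variable $x$ is, from some point on, free in every sequent and the branch passes instances of $\textsc{Case}_x$ infinitely often. -}

module Defs where

open import Data.Nat using (ℕ; zero; suc; _≤_; _≡ᵇ_)
open import Data.Fin using (Fin) renaming (zero to fz; suc to fs)
open import Data.List using (List; []; _∷_; map; _++_; [_]; concatMap)
open import Data.List.Membership.Propositional using (_∈_; _∉_)
open import Data.List.Relation.Unary.All using (All)
open import Data.List.Relation.Binary.Pointwise using (Pointwise)
open import Data.Maybe using (Maybe; just; nothing)
open import Data.Product using (Σ; ∃; _×_; _,_)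
open import Data.Sum using (_⊎_)
open import Data.Bool using (if_then_else_)
open import Relation.Binary.PropositionalEquality using (_≡_; _≢_)

-- Syntax (locally nameless, well-scoped): free variables are named by ℕ,
-- bound variables are de Bruijn indices Fin n.  Sequent formulas are Fm 0.

data Tm (n : ℕ) : Set where
  fv   : ℕ → Tm n
  bv   : Fin n → Tm n
  `0   : Tm n
  `S   : Tm n → Tm n
  _`+_ : Tm n → Tm n → Tm n
  _`·_ : Tm n → Tm n → Tm n

data Fm (n : ℕ) : Set where
  _`=_ : Tm n → Tm n → Fm n
  `⊥   : Fm n
  _`∧_ : Fm n → Fm n → Fm n
  _`∨_ : Fm n → Fm n → Fm n
  _`→_ : Fm n → Fm n → Fm n
  `∀   : Fm (suc n) → Fm n
  `∃   : Fm (suc n) → Fm n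

rename : ∀ {n m} → (Fin n → Fin m) → Tm n → Tm m
rename r (fv x) = fv x
rename r (bv i) = bv (r i)
rename r `0 = `0
rename r (`S t) = `S (rename r t)
rename r (s `+ t) = rename r s `+ rename r t
rename r (s `· t) = rename r s `· rename r t

substT : ∀ {n m} → (ℕ → Tm m) → (Fin n → Tm m) → Tm n → Tm m
substT σ ρ (fv x) = σ x
substT σ ρ (bv i) = ρ i
substT σ ρ `0 = `0
substT σ ρ (`S t) = `S (substT σ ρ t)
substT σ ρ (s `+ t) = substT σ ρ s `+ substT σ ρ t
substT σ ρ (s `· t) = substT σ ρ s `· substT σ ρ t

liftσ : ∀ {m} → (ℕ → Tm m) → ℕ → Tm (suc m)
liftσ σ x = rename fs (σ x)

extρ : ∀ {n m} → (Fin n → Tm m) → Fin (suc n) → Tm (suc m)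
extρ ρ fz = bv fz
extρ ρ (fs i) = rename fs (ρ i)

substF : ∀ {n m} → (ℕ → Tm m) → (Fin n → Tm m) → Fm n → Fm m
substF σ ρ (s `= t) = substT σ ρ s `= substT σ ρ t
substF σ ρ `⊥ = `⊥
substF σ ρ (φ `∧ ψ) = substF σ ρ φ `∧ substF σ ρ ψ
substF σ ρ (φ `∨ ψ) = substF σ ρ φ `∨ substF σ ρ ψ
substF σ ρ (φ `→ ψ) = substF σ ρ φ `→ substF σ ρ ψ
substF σ ρ (`∀ φ) = `∀ (substF (liftσ σ) (extρ ρ) φ)
substF σ ρ (`∃ φ) = `∃ (substF (liftσ σ) (extρ ρ) φ)

noBound : Fin 0 → Tm 0
noBound ()

_⟦_⟧ : Fm 0 → (ℕ → Tm 0) → Fm 0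
φ ⟦ σ ⟧ = substF σ noBound φ

-- φ(t) for φ(x) a formula with one distinguished (bound) variable
inst : Fm 1 → Tm 0 → Fm 0
inst φ t = substF fv (λ _ → t) φ

[_/_] : Tm 0 → ℕ → ℕ → Tm 0
[ t / x ] z = if z ≡ᵇ x then t else fv z

[_/_,_/_] : Tm 0 → ℕ → Tm 0 → ℕ → ℕ → Tm 0
[ s / x , t / y ] z = if z ≡ᵇ x then s else (if z ≡ᵇ y then t else fv z)

fvT : ∀ {n} → Tm n → List ℕ
fvT (fv x) = x ∷ []
fvT (bv i) = []
fvT `0 = []
fvT (`S t) = fvT t
fvT (s `+ t) = fvT s ++ fvT t
fvT (s `· t) = fvT s ++ fvT t

fvF : ∀ {n} → Fm n → List ℕ
fvF (s `= t) = fvT s ++ fvT t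
fvF `⊥ = []
fvF (φ `∧ ψ) = fvF φ ++ fvF ψ
fvF (φ `∨ ψ) = fvF φ ++ fvF ψ
fvF (φ `→ ψ) = fvF φ ++ fvF ψ
fvF (`∀ φ) = fvF φ
fvF (`∃ φ) = fvF φ

fvΓ : List (Fm 0) → List ℕ
fvΓ = concatMap fvF

-- Sequents Γ ⇒ δ ; Γ is a finite set, represented by a list taken
-- modulo set-equality (_≈S_ below).

record Seq : Set where
  constructor _⇒_
  field
    ante : List (Fm 0)
    succ : Fm 0
open Seq public

fvS : Seq → List ℕ
fvS (Γ ⇒ δ) = fvΓ Γ ++ fvF δ

subS : (ℕ → Tm 0) → Seq → Seq
subS σ (Γ ⇒ δ) = map (λ φ → φ ⟦ σ ⟧) Γ ⇒ (δ ⟦ σ ⟧)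

addL : Fm 0 → Seq → Seq
addL φ (Γ ⇒ δ) = (φ ∷ Γ) ⇒ δ

_≈S_ : Seq → Seq → Set
(Γ ⇒ δ) ≈S (Γ' ⇒ δ') =
  ((∀ φ → φ ∈ Γ → φ ∈ Γ') × (∀ φ → φ ∈ Γ' → φ ∈ Γ)) × δ ≡ δ'

Rel : Set₁
Rel = List Seq → Seq → Set

Cl : Rel → Rel
Cl R ps s = Σ (List Seq) λ ps' → Σ Seq λ s' →
  R ps' s' × Pointwise _≈S_ ps ps' × s ≈S s'

¬' : Fm 0 → Fm 0
¬' φ = φ `→ `⊥

-- Rules common to HA and CHA (everything except induction / Case)

data R₀ : Rel where
  ax   : ∀ Γ δ → R₀ [] ((δ ∷ Γ) ⇒ δ)
  →L   : ∀ Γ φ ψ δ → R₀ ((Γ ⇒ φ) ∷ ((ψ ∷ Γ) ⇒ δ) ∷ []) (((φ `→ ψ) ∷ Γ) ⇒ δ)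
  →R   : ∀ Γ φ ψ → R₀ [ (φ ∷ Γ) ⇒ ψ ] (Γ ⇒ (φ `→ ψ))
  ∧L   : ∀ Γ φ ψ δ → R₀ [ (φ ∷ ψ ∷ Γ) ⇒ δ ] (((φ `∧ ψ) ∷ Γ) ⇒ δ)
  ∧R   : ∀ Γ φ ψ → R₀ ((Γ ⇒ φ) ∷ (Γ ⇒ ψ) ∷ []) (Γ ⇒ (φ `∧ ψ))
  ∨L   : ∀ Γ φ ψ δ → R₀ (((φ ∷ Γ) ⇒ δ) ∷ ((ψ ∷ Γ) ⇒ δ) ∷ []) (((φ `∨ ψ) ∷ Γ) ⇒ δ)
  ∨R₁  : ∀ Γ φ ψ → R₀ [ Γ ⇒ φ ] (Γ ⇒ (φ `∨ ψ))
  ∨R₂  : ∀ Γ φ ψ → R₀ [ Γ ⇒ ψ ] (Γ ⇒ (φ `∨ ψ))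
  ∀L   : ∀ Γ φ δ (t : Tm 0) → R₀ [ (inst φ t ∷ Γ) ⇒ δ ] ((`∀ φ ∷ Γ) ⇒ δ)
  ∀R   : ∀ Γ φ y → y ∉ fvΓ Γ → y ∉ fvF (`∀ φ) →
         R₀ [ Γ ⇒ inst φ (fv y) ] (Γ ⇒ `∀ φ)
  ∃L   : ∀ Γ φ δ y → y ∉ fvΓ Γ → y ∉ fvF (`∃ φ) → y ∉ fvF δ →
         R₀ [ (inst φ (fv y) ∷ Γ) ⇒ δ ] ((`∃ φ ∷ Γ) ⇒ δ)
  ∃R   : ∀ Γ φ (t : Tm 0) → R₀ [ Γ ⇒ inst φ t ] (Γ ⇒ `∃ φ)
  ⊥L   : ∀ Γ δ → R₀ [] ((`⊥ ∷ Γ) ⇒ δ)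
  =L   : ∀ Γ δ x y (s t : Tm 0) → x ≢ y →
         x ∉ fvT s → x ∉ fvT t → y ∉ fvT s → y ∉ fvT t →
         R₀ [ subS [ fv x / y ] (Γ ⇒ δ) ]
            (addL (s `= t) (subS [ s / x , t / y ] (Γ ⇒ δ)))
  =R   : ∀ Γ (t : Tm 0) → R₀ [] (Γ ⇒ (t `= t))
  wk   : ∀ Γ φ δ → R₀ [ Γ ⇒ δ ] ((φ ∷ Γ) ⇒ δ)
  cut  : ∀ Γ φ δ → R₀ ((Γ ⇒ φ) ∷ ((φ ∷ Γ) ⇒ δ) ∷ []) (Γ ⇒ δ)
  ax0S : ∀ (t : Tm 0) → R₀ [] ([] ⇒ ¬' (`0 `= `S t))
  axSS : ∀ (s t : Tm 0) → R₀ [] ([ `S s `= `S t ] ⇒ (s `= t))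
  ax+0 : ∀ (s : Tm 0) → R₀ [] ([] ⇒ ((s `+ `0) `= s))
  ax+S : ∀ (s t : Tm 0) → R₀ [] ([] ⇒ ((s `+ `S t) `= `S (s `+ t)))
  ax·0 : ∀ (s : Tm 0) → R₀ [] ([] ⇒ ((s `· `0) `= `0))
  ax·S : ∀ (s t : Tm 0) → R₀ [] ([] ⇒ ((s `· `S t) `= ((s `· t) `+ s)))

data IndAx : Rel where
  ind : ∀ (φ : Fm 1) (s : Tm 0) →
        IndAx [] ((inst φ `0 ∷ `∀ (φ `→ substF fv (λ _ → `S (bv fz)) φ) ∷ []) ⇒ inst φ s)

data CaseR (x : ℕ) : Rel where
  case : ∀ S → CaseR x (subS [ `0 / x ] S ∷ subS [ `S (fv x) / x ] S ∷ []) S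

HARule : Rel
HARule = Cl (λ ps s → R₀ ps s ⊎ IndAx ps s)

data HA⊢_ (S : Seq) : Set where
  by : (ps : List Seq) → HARule ps S → All HA⊢_ ps → HA⊢ S

data Kind : Set where
  base : Kind
  caseK : ℕ → Kind

KRule : Kind → Rel
KRule base = Cl R₀
KRule (caseK x) = Cl (CaseR x)

data Tree : Set where
  bud  : Seq → Tree
  node : Seq → Kind → List Tree → Tree

label : Tree → Seq
label (bud s) = s
label (node s k cs) = s

Pos : Set
Pos = List ℕ

mutual
  _at_ : Tree → Pos → Maybe Tree
  T at [] = just T
  bud s at (i ∷ p) = nothing
  node s k cs at (i ∷ p) = atL cs i p

  atL : List Tree → ℕ → Pos → Maybe Tree
  atL [] i p = nothing
  atL (c ∷ cs) zero p = c at p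
  atL (c ∷ cs) (suc i) p = atL cs i p

record PreProof : Set where
  field
    tree : Tree
    comp : Pos → Pos      -- companion map β (only meaningful on buds)
    local : ∀ p s k cs → tree at p ≡ just (node s k cs) → KRule k (map label cs) s
    buds  : ∀ p s → tree at p ≡ just (bud s) →
            Σ Seq λ s' → Σ Kind λ k → Σ Tree λ c → Σ (List Tree) λ cs →
              (tree at comp p ≡ just (node s' k (c ∷ cs))) × (s ≈S s')
open PreProof public

Step : PreProof → Pos → Pos → Set
Step P p q =
  (Σ ℕ λ i → (q ≡ p ++ [ i ]) × Σ Tree λ T → tree P at q ≡ just T)
  ⊎ ((Σ Seq λ s → tree P at p ≡ just (bud s)) × q ≡ comp P p)

InfBranch : PreProof → (ℕ → Pos) → Set
InfBranch P b = (b 0 ≡ []) × (∀ i → Step P (b i) (b (suc i)))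

FreeAt : PreProof → ℕ → Pos → Set
FreeAt P x p = Σ Tree λ T → (tree P at p ≡ just T) × (x ∈ fvS (label T))

CaseAt : PreProof → ℕ → Pos → Set
CaseAt P x p = Σ Seq λ s → Σ (List Tree) λ cs → tree P at p ≡ just (node s (caseK x) cs)

GoodBranch : PreProof → (ℕ → Pos) → Set
GoodBranch P b = Σ ℕ λ x → Σ ℕ λ N →
  (∀ i → N ≤ i → FreeAt P x (b i)) ×
  (∀ i → Σ ℕ λ j → (i ≤ j) × CaseAt P x (b j))

record CHA⊢_ (S : Seq) : Set where
  field
    proof  : PreProof
    root   : label (tree proof) ≡ S
    global : ∀ b → InfBranch proof b → GoodBranch proof b

module Submission where

-- Every rule of HA except induction is a rule of CHA, and placing one rule instance on top of cyclic
-- proofs of its premises gives a cyclic proof again: an infinite branch enters one premise at its first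
-- step and never leaves it, because the companions of that premise's buds lie inside it.  So it remains to
-- derive each induction axiom  φ(0), ∀x.φ(x) → φ(Sx) ⇒ φ(s).  A cut with ∀x.φ(x) reduces it to
-- y = y, φ(0), ∀x.φ(x) → φ(Sx) ⇒ φ(y) for a fresh y, which is proved by Case_y: the case 0 is an axiom,
-- and the case Sy follows from φ(y) → φ(Sy) together with a bud pointing back to the Case_y node.  Every
-- infinite branch eventually runs around this single cycle, on which y stays free.

open import Data.Bool using (true; false)
open import Data.Empty using (⊥; ⊥-elim)
open import Data.Product using (Σ; _×_; _,_; proj₁; proj₂)
open import Data.Sum using (_⊎_; inj₁; inj₂)
open import Data.Fin using (Fin) renaming (zero to fz; suc to fs)
open import Data.List using (List; []; _∷_; _++_; [_]; map; drop)
open import Data.List.Extrema.Nat using (max; xs≤max)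
open import Data.List.Membership.Propositional using (_∈_; _∉_)
open import Data.List.Membership.Propositional.Properties using (∈-++⁺ˡ; ∈-++⁺ʳ; ∈-++⁻)
open import Data.List.Relation.Binary.Subset.Propositional using (_⊆_)
open import Data.List.Relation.Binary.Subset.Propositional.Properties using (++⁺)
open import Data.List.Relation.Unary.All as All using (All; []; _∷_)
open import Data.List.Relation.Unary.Any using (here; there)
open import Data.List.Relation.Binary.Pointwise as Pointwise using ([]; _∷_)
open import Data.Maybe using (Maybe; just)
open import Data.Nat using (ℕ; zero; suc; _+_; _≤_; s≤s; _≡ᵇ_)
open import Data.Nat.GeneralisedArithmetic using (fold; fold-+)
open import Data.Nat.Properties using (<-irrefl; m≤n+m; ≤-trans; n≤1+n; ≡⇒≡ᵇ; ≡ᵇ⇒≡)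
open import Function using (id; _∘_)
open import Relation.Nullary using (¬_)
open import Relation.Binary.PropositionalEquality
  using (_≡_; _≢_; refl; sym; trans; cong; cong₂; subst)

open import Defs

private
  variable
    n m k : ℕ
    σ₁ σ₃ : ℕ → Tm m
    ρ₁ ρ₃ : Fin n → Tm m

fvT-rename : (r : Fin n → Fin m) (t : Tm n) → fvT (rename r t) ≡ fvT t
fvT-rename r (fv x) = refl
fvT-rename r (bv i) = refl
fvT-rename r `0 = refl
fvT-rename r (`S t) = fvT-rename r t
fvT-rename r (s `+ t) = cong₂ _++_ (fvT-rename r s) (fvT-rename r t)
fvT-rename r (s `· t) = cong₂ _++_ (fvT-rename r s) (fvT-rename r t)

substT-lift-rename : (σ : ℕ → Tm m) (ρ : Fin n → Tm m) (t : Tm n) →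
  substT (liftσ σ) (extρ ρ) (rename fs t) ≡ rename fs (substT σ ρ t)
substT-lift-rename σ ρ (fv x) = refl
substT-lift-rename σ ρ (bv i) = refl
substT-lift-rename σ ρ `0 = refl
substT-lift-rename σ ρ (`S t) = cong `S (substT-lift-rename σ ρ t)
substT-lift-rename σ ρ (s `+ t) = cong₂ _`+_ (substT-lift-rename σ ρ s) (substT-lift-rename σ ρ t)
substT-lift-rename σ ρ (s `· t) = cong₂ _`·_ (substT-lift-rename σ ρ s) (substT-lift-rename σ ρ t)

substT-∘ : {σ₂ : ℕ → Tm k} {ρ₂ : Fin m → Tm k} →
  (∀ x → substT σ₂ ρ₂ (σ₁ x) ≡ σ₃ x) → (∀ i → substT σ₂ ρ₂ (ρ₁ i) ≡ ρ₃ i) →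
  ∀ t → substT σ₂ ρ₂ (substT σ₁ ρ₁ t) ≡ substT σ₃ ρ₃ t
substT-∘ hσ hρ (fv x) = hσ x
substT-∘ hσ hρ (bv i) = hρ i
substT-∘ hσ hρ `0 = refl
substT-∘ hσ hρ (`S t) = cong `S (substT-∘ hσ hρ t)
substT-∘ hσ hρ (s `+ t) = cong₂ _`+_ (substT-∘ hσ hρ s) (substT-∘ hσ hρ t)
substT-∘ hσ hρ (s `· t) = cong₂ _`·_ (substT-∘ hσ hρ s) (substT-∘ hσ hρ t)

module _ {σ₂ : ℕ → Tm k} {ρ₂ : Fin m → Tm k} where

  liftσ-∘ : (σ₁ : ℕ → Tm m) → (∀ x → substT σ₂ ρ₂ (σ₁ x) ≡ σ₃ x) →
    ∀ x → substT (liftσ σ₂) (extρ ρ₂) (liftσ σ₁ x) ≡ liftσ σ₃ x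
  liftσ-∘ σ₁ hσ x = trans (substT-lift-rename σ₂ ρ₂ (σ₁ x)) (cong (rename fs) (hσ x))

  extρ-∘ : (ρ₁ : Fin n → Tm m) → (∀ i → substT σ₂ ρ₂ (ρ₁ i) ≡ ρ₃ i) →
    ∀ i → substT (liftσ σ₂) (extρ ρ₂) (extρ ρ₁ i) ≡ extρ ρ₃ i
  extρ-∘ ρ₁ hρ fz = refl
  extρ-∘ ρ₁ hρ (fs i) = trans (substT-lift-rename σ₂ ρ₂ (ρ₁ i)) (cong (rename fs) (hρ i))

substF-∘ : {σ₂ : ℕ → Tm k} {ρ₂ : Fin m → Tm k} →
  (∀ x → substT σ₂ ρ₂ (σ₁ x) ≡ σ₃ x) → (∀ i → substT σ₂ ρ₂ (ρ₁ i) ≡ ρ₃ i) →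
  ∀ φ → substF σ₂ ρ₂ (substF σ₁ ρ₁ φ) ≡ substF σ₃ ρ₃ φ
substF-∘ hσ hρ (s `= t) = cong₂ _`=_ (substT-∘ hσ hρ s) (substT-∘ hσ hρ t)
substF-∘ hσ hρ `⊥ = refl
substF-∘ hσ hρ (φ `∧ ψ) = cong₂ _`∧_ (substF-∘ hσ hρ φ) (substF-∘ hσ hρ ψ)
substF-∘ hσ hρ (φ `∨ ψ) = cong₂ _`∨_ (substF-∘ hσ hρ φ) (substF-∘ hσ hρ ψ)
substF-∘ hσ hρ (φ `→ ψ) = cong₂ _`→_ (substF-∘ hσ hρ φ) (substF-∘ hσ hρ ψ)
substF-∘ {σ₁ = σ₁} {ρ₁ = ρ₁} hσ hρ (`∀ φ) = cong `∀ (substF-∘ (liftσ-∘ σ₁ hσ) (extρ-∘ ρ₁ hρ) φ)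
substF-∘ {σ₁ = σ₁} {ρ₁ = ρ₁} hσ hρ (`∃ φ) = cong `∃ (substF-∘ (liftσ-∘ σ₁ hσ) (extρ-∘ ρ₁ hρ) φ)

substT-cong : {σ σ' : ℕ → Tm m} (ρ : Fin n → Tm m) (t : Tm n) →
  (∀ {x} → x ∈ fvT t → σ x ≡ σ' x) → substT σ ρ t ≡ substT σ' ρ t
substT-cong ρ (fv x) h = h (here refl)
substT-cong ρ (bv i) h = refl
substT-cong ρ `0 h = refl
substT-cong ρ (`S t) h = cong `S (substT-cong ρ t h)
substT-cong ρ (s `+ t) h =
  cong₂ _`+_ (substT-cong ρ s (h ∘ ∈-++⁺ˡ)) (substT-cong ρ t (h ∘ ∈-++⁺ʳ (fvT s)))
substT-cong ρ (s `· t) h =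
  cong₂ _`·_ (substT-cong ρ s (h ∘ ∈-++⁺ˡ)) (substT-cong ρ t (h ∘ ∈-++⁺ʳ (fvT s)))

substF-cong : {σ σ' : ℕ → Tm m} (ρ : Fin n → Tm m) (φ : Fm n) →
  (∀ {x} → x ∈ fvF φ → σ x ≡ σ' x) → substF σ ρ φ ≡ substF σ' ρ φ
substF-cong ρ (s `= t) h =
  cong₂ _`=_ (substT-cong ρ s (h ∘ ∈-++⁺ˡ)) (substT-cong ρ t (h ∘ ∈-++⁺ʳ (fvT s)))
substF-cong ρ `⊥ h = refl
substF-cong ρ (φ `∧ ψ) h =
  cong₂ _`∧_ (substF-cong ρ φ (h ∘ ∈-++⁺ˡ)) (substF-cong ρ ψ (h ∘ ∈-++⁺ʳ (fvF φ)))
substF-cong ρ (φ `∨ ψ) h =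
  cong₂ _`∨_ (substF-cong ρ φ (h ∘ ∈-++⁺ˡ)) (substF-cong ρ ψ (h ∘ ∈-++⁺ʳ (fvF φ)))
substF-cong ρ (φ `→ ψ) h =
  cong₂ _`→_ (substF-cong ρ φ (h ∘ ∈-++⁺ˡ)) (substF-cong ρ ψ (h ∘ ∈-++⁺ʳ (fvF φ)))
substF-cong ρ (`∀ φ) h = cong `∀ (substF-cong (extρ ρ) φ (cong (rename fs) ∘ h))
substF-cong ρ (`∃ φ) h = cong `∃ (substF-cong (extρ ρ) φ (cong (rename fs) ∘ h))

substT-id : (ρ : Fin n → Tm n) → (∀ i → ρ i ≡ bv i) → ∀ t → substT fv ρ t ≡ t
substT-id ρ h (fv x) = refl
substT-id ρ h (bv i) = h i
substT-id ρ h `0 = refl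
substT-id ρ h (`S t) = cong `S (substT-id ρ h t)
substT-id ρ h (s `+ t) = cong₂ _`+_ (substT-id ρ h s) (substT-id ρ h t)
substT-id ρ h (s `· t) = cong₂ _`·_ (substT-id ρ h s) (substT-id ρ h t)

extρ-id : {ρ : Fin n → Tm n} → (∀ i → ρ i ≡ bv i) → ∀ i → extρ ρ i ≡ bv i
extρ-id h fz = refl
extρ-id h (fs i) = cong (rename fs) (h i)

substF-id : (ρ : Fin n → Tm n) → (∀ i → ρ i ≡ bv i) → ∀ φ → substF fv ρ φ ≡ φ
substF-id ρ h (s `= t) = cong₂ _`=_ (substT-id ρ h s) (substT-id ρ h t)
substF-id ρ h `⊥ = refl
substF-id ρ h (φ `∧ ψ) = cong₂ _`∧_ (substF-id ρ h φ) (substF-id ρ h ψ)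
substF-id ρ h (φ `∨ ψ) = cong₂ _`∨_ (substF-id ρ h φ) (substF-id ρ h ψ)
substF-id ρ h (φ `→ ψ) = cong₂ _`→_ (substF-id ρ h φ) (substF-id ρ h ψ)
substF-id ρ h (`∀ φ) = cong `∀ (substF-id (extρ ρ) (extρ-id h) φ)
substF-id ρ h (`∃ φ) = cong `∃ (substF-id (extρ ρ) (extρ-id h) φ)

Closed : Tm n → Set
Closed t = fvT t ≡ []

fvT-substT⊆ : (ρ : Fin n → Tm m) → (∀ i → Closed (ρ i)) → ∀ t → fvT (substT fv ρ t) ⊆ fvT t
fvT-substT⊆ ρ h (fv x) = id
fvT-substT⊆ ρ h (bv i) rewrite h i = λ ()
fvT-substT⊆ ρ h `0 = id
fvT-substT⊆ ρ h (`S t) = fvT-substT⊆ ρ h t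
fvT-substT⊆ ρ h (s `+ t) = ++⁺ (fvT-substT⊆ ρ h s) (fvT-substT⊆ ρ h t)
fvT-substT⊆ ρ h (s `· t) = ++⁺ (fvT-substT⊆ ρ h s) (fvT-substT⊆ ρ h t)

extρ-closed : {ρ : Fin n → Tm m} → (∀ i → Closed (ρ i)) → ∀ i → Closed (extρ ρ i)
extρ-closed h fz = refl
extρ-closed {ρ = ρ} h (fs i) = trans (fvT-rename fs (ρ i)) (h i)

fvF-substF⊆ : (ρ : Fin n → Tm m) → (∀ i → Closed (ρ i)) → ∀ φ → fvF (substF fv ρ φ) ⊆ fvF φ
fvF-substF⊆ ρ h (s `= t) = ++⁺ (fvT-substT⊆ ρ h s) (fvT-substT⊆ ρ h t)
fvF-substF⊆ ρ h `⊥ = id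
fvF-substF⊆ ρ h (φ `∧ ψ) = ++⁺ (fvF-substF⊆ ρ h φ) (fvF-substF⊆ ρ h ψ)
fvF-substF⊆ ρ h (φ `∨ ψ) = ++⁺ (fvF-substF⊆ ρ h φ) (fvF-substF⊆ ρ h ψ)
fvF-substF⊆ ρ h (φ `→ ψ) = ++⁺ (fvF-substF⊆ ρ h φ) (fvF-substF⊆ ρ h ψ)
fvF-substF⊆ ρ h (`∀ φ) = fvF-substF⊆ (extρ ρ) (extρ-closed h) φ
fvF-substF⊆ ρ h (`∃ φ) = fvF-substF⊆ (extρ ρ) (extρ-closed h) φ

[/]-self : ∀ t x → [ t / x ] x ≡ t
[/]-self t x with x ≡ᵇ x | ≡⇒≡ᵇ x x refl
... | true | _ = refl

[/]-other : ∀ t {x z} → z ≢ x → [ t / x ] z ≡ fv z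
[/]-other t {x} {z} z≢x with z ≡ᵇ x | ≡ᵇ⇒≡ z x
... | false | _ = refl
... | true | z≡x = ⊥-elim (z≢x (z≡x _))

⟦⟧-fresh : ∀ t {y} ψ → y ∉ fvF ψ → ψ ⟦ [ t / y ] ⟧ ≡ ψ
⟦⟧-fresh t ψ y∉ =
  trans (substF-cong noBound ψ (λ x∈ → [/]-other t (λ { refl → y∉ x∈ })))
        (substF-id noBound (λ ()) ψ)

map-⟦⟧-fresh : ∀ t {y} Γ → y ∉ fvΓ Γ → map (λ ψ → ψ ⟦ [ t / y ] ⟧) Γ ≡ Γ
map-⟦⟧-fresh t [] y∉ = refl
map-⟦⟧-fresh t (ψ ∷ Γ) y∉ =
  cong₂ _∷_ (⟦⟧-fresh t ψ (y∉ ∘ ∈-++⁺ˡ)) (map-⟦⟧-fresh t Γ (y∉ ∘ ∈-++⁺ʳ (fvF ψ)))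

inst-⟦⟧-fresh : ∀ φ t {y} → y ∉ fvF φ → inst φ (fv y) ⟦ [ t / y ] ⟧ ≡ inst φ t
inst-⟦⟧-fresh φ t {y} y∉ =
  trans (substF-∘ {σ₃ = [ t / y ]} {ρ₃ = λ _ → t} (λ _ → refl) (λ _ → [/]-self t y) φ)
        (substF-cong (λ _ → t) φ (λ x∈ → [/]-other t (λ { refl → y∉ x∈ })))

inst-inst : ∀ φ (u : Tm 1) t → inst (substF fv (λ _ → u) φ) t ≡ inst φ (substT fv (λ _ → t) u)
inst-inst φ u t = substF-∘ (λ _ → refl) (λ _ → refl) φ

++-⊆ : ∀ {A : Set} {xs ys zs : List A} → xs ⊆ zs → ys ⊆ zs → xs ++ ys ⊆ zs
++-⊆ {xs = xs} xs⊆ ys⊆ v∈ with ∈-++⁻ xs v∈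
... | inj₁ v∈xs = xs⊆ v∈xs
... | inj₂ v∈ys = ys⊆ v∈ys

fresh : List ℕ → ℕ
fresh xs = suc (max 0 xs)

fresh-∉ : ∀ xs → fresh xs ∉ xs
fresh-∉ xs x∈xs = <-irrefl refl (All.lookup (xs≤max 0 xs) x∈xs)

≈S-refl : ∀ {s} → s ≈S s
≈S-refl {Γ ⇒ δ} = ((λ _ → id) , (λ _ → id)) , refl

≡⇒≈S : ∀ {s s'} → s ≡ s' → s ≈S s'
≡⇒≈S refl = ≈S-refl

swap-≈S : ∀ {φ ψ Γ δ} → ((φ ∷ ψ ∷ Γ) ⇒ δ) ≈S ((ψ ∷ φ ∷ Γ) ⇒ δ)
swap-≈S = (swap , swap) , refl
  where
  swap : ∀ {φ ψ Γ} χ → χ ∈ φ ∷ ψ ∷ Γ → χ ∈ ψ ∷ φ ∷ Γ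
  swap χ (here e) = there (here e)
  swap χ (there (here e)) = here e
  swap χ (there (there χ∈)) = there (there χ∈)

absorb-≈S : ∀ {φ Γ δ} → φ ∈ Γ → (Γ ⇒ δ) ≈S ((φ ∷ Γ) ⇒ δ)
absorb-≈S {φ} {Γ} φ∈Γ = ((λ _ → there) , absorb) , refl
  where
  absorb : ∀ χ → χ ∈ φ ∷ Γ → χ ∈ Γ
  absorb χ (here refl) = φ∈Γ
  absorb χ (there χ∈) = χ∈

exactly : ∀ {ps s} → R₀ ps s → Cl R₀ ps s
exactly r = _ , _ , r , Pointwise.refl ≈S-refl , ≈S-refl

mutual
  at-++ : ∀ T p q {T'} → T at p ≡ just T' → T at (p ++ q) ≡ T' at q
  at-++ T [] q refl = refl
  at-++ (node s k cs) (i ∷ p) q e = atL-++ cs i p q e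

  atL-++ : ∀ cs i p q {T'} → atL cs i p ≡ just T' → atL cs i (p ++ q) ≡ T' at q
  atL-++ (c ∷ cs) zero p q e = at-++ c p q e
  atL-++ (c ∷ cs) (suc i) p q e = atL-++ cs i p q e

Stuck₂ : PreProof → Pos → Set
Stuck₂ P p = ∀ {q r} → Step P p q → Step P q r → ⊥

module _ (P : PreProof) where

  leaf-stuck : ∀ {p s k q} → tree P at p ≡ just (node s k []) → ¬ Step P p q
  leaf-stuck {p} e (inj₁ (j , refl , _ , a)) with () ← trans (sym (at-++ (tree P) p [ j ] e)) a
  leaf-stuck e (inj₂ ((_ , a) , _)) with () ← trans (sym e) a

  leaf-stuck₂ : ∀ p {s k} → tree P at p ≡ just (node s k []) → Stuck₂ P p
  leaf-stuck₂ p e st _ = leaf-stuck e st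

  unary-leaf-stuck₂ : ∀ p {s k s' k'} → tree P at p ≡ just (node s k [ node s' k' [] ]) → Stuck₂ P p
  unary-leaf-stuck₂ p e (inj₁ (zero , refl , _)) = leaf-stuck (at-++ (tree P) p [ 0 ] e)
  unary-leaf-stuck₂ p e (inj₁ (suc j , refl , _ , a))
    with () ← trans (sym (at-++ (tree P) p [ suc j ] e)) a
  unary-leaf-stuck₂ p e (inj₂ ((_ , a) , _)) with () ← trans (sym e) a

data ProofTree (C : Seq) : Tree → Set where
  bud≈ : ∀ {s} → s ≈S C → ProofTree C (bud s)
  rule : ∀ {s k cs} → KRule k (map label cs) s → All (ProofTree C) cs → ProofTree C (node s k cs)

module _ {C : Seq} where

  mutual
    ProofTree-at : ∀ {T T'} p → ProofTree C T → T at p ≡ just T' → ProofTree C T'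
    ProofTree-at [] d refl = d
    ProofTree-at (i ∷ p) (rule _ ds) e = ProofTree-atL i p ds e

    ProofTree-atL : ∀ {cs T'} i p → All (ProofTree C) cs → atL cs i p ≡ just T' → ProofTree C T'
    ProofTree-atL zero p (d ∷ _) e = ProofTree-at p d e
    ProofTree-atL (suc i) p (_ ∷ ds) e = ProofTree-atL i p ds e

  singleCompanion : ∀ {k t ts} (T : Tree) (c : Pos) → ProofTree C T →
    T at c ≡ just (node C k (t ∷ ts)) → PreProof
  singleCompanion {k} {t} {ts} T c d companion = record
    { tree = T
    ; comp = λ _ → c
    ; local = λ p _ _ _ e → rule-of (ProofTree-at p d e)
    ; buds = λ p _ e → C , k , t , ts , companion , bud-of (ProofTree-at p d e)
    }
    where
    rule-of : ∀ {s k cs} → ProofTree C (node s k cs) → KRule k (map label cs) s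
    rule-of (rule r _) = r

    bud-of : ∀ {s} → ProofTree C (bud s) → s ≈S C
    bud-of (bud≈ s≈C) = s≈C

GlobalTrace : PreProof → Set
GlobalTrace P = ∀ b → InfBranch P b → GoodBranch P b

compAt : List PreProof → ℕ → Pos → Pos
compAt [] i = id
compAt (P ∷ Ps) zero = comp P
compAt (P ∷ Ps) (suc i) = compAt Ps i

record Component (subtreeAt : Pos → Maybe Tree) (companion : Pos → Pos) : Set where
  field
    sub : PreProof
    sub-trace : GlobalTrace sub
    at-≡ : ∀ p → subtreeAt p ≡ tree sub at p
    comp-≡ : ∀ p → companion p ≡ comp sub p

component : ∀ {Ps} i → All GlobalTrace Ps → ∀ {p T} → atL (map tree Ps) i p ≡ just T →
  Component (atL (map tree Ps) i) (compAt Ps i)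
component {P ∷ _} zero (g ∷ _) _ =
  record { sub = P ; sub-trace = g ; at-≡ = λ _ → refl ; comp-≡ = λ _ → refl }
component {_ ∷ _} (suc i) (_ ∷ gs) e = component i gs e

module Graft (S : Seq) (Ps : List PreProof) (r : Cl R₀ (map label (map tree Ps)) S)
             (traces : All GlobalTrace Ps) where

  T₀ : Tree
  T₀ = node S base (map tree Ps)

  comp₀ : Pos → Pos
  comp₀ [] = []
  comp₀ (i ∷ p) = i ∷ compAt Ps i p

  local₀ : ∀ p s k cs → T₀ at p ≡ just (node s k cs) → KRule k (map label cs) s
  local₀ [] s k cs refl = r
  local₀ (i ∷ p) s k cs e = local sub p s k cs (trans (sym (at-≡ p)) e)
    where open Component (component i traces e)

  buds₀ : ∀ p s → T₀ at p ≡ just (bud s) →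
    Σ Seq λ s' → Σ Kind λ k → Σ Tree λ c → Σ (List Tree) λ cs →
      (T₀ at comp₀ p ≡ just (node s' k (c ∷ cs))) × (s ≈S s')
  buds₀ (i ∷ p) s e =
    let s' , k , c , cs , companion , s≈s' = buds sub p s (trans (sym (at-≡ p)) e)
    in s' , k , c , cs , trans (cong (atL (map tree Ps) i) (comp-≡ p)) (trans (at-≡ _) companion) ,
       s≈s'
    where open Component (component i traces e)

  grafted : PreProof
  grafted = record { tree = T₀ ; comp = comp₀ ; local = local₀ ; buds = buds₀ }

  module _ (b : ℕ → Pos) (ib : InfBranch grafted b) where

    first-step : ∀ {q} → Step grafted [] q →
      Σ ℕ λ i → (q ≡ i ∷ []) × Σ Tree λ T → atL (map tree Ps) i [] ≡ just T
    first-step (inj₁ (i , refl , T , a)) = i , refl , T , a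
    first-step (inj₂ ((_ , ()) , _))

    first : Σ ℕ λ i → (b 1 ≡ i ∷ []) × Σ Tree λ T → atL (map tree Ps) i [] ≡ just T
    first = first-step (subst (λ p → Step grafted p (b 1)) (proj₁ ib) (proj₂ ib 0))

    i₀ : ℕ
    i₀ = proj₁ first

    open Component (component i₀ traces (proj₂ (proj₂ (proj₂ first))))

    step-inside : ∀ {p q} → Step grafted (i₀ ∷ p) q → Step sub p (drop 1 q) × (q ≡ i₀ ∷ drop 1 q)
    step-inside {p} (inj₁ (j , refl , T , a)) =
      inj₁ (j , refl , T , trans (sym (at-≡ (p ++ [ j ]))) a) , refl
    step-inside {p} (inj₂ ((s , a) , refl)) = inj₂ ((s , trans (sym (at-≡ p)) a) , comp-≡ p) , refl

    b′ : ℕ → Pos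
    b′ k = drop 1 (b (suc k))

    mutual
      stays-inside : ∀ k → b (suc k) ≡ i₀ ∷ b′ k
      stays-inside zero = trans b1 (cong (λ p → i₀ ∷ drop 1 p) (sym b1))
        where b1 = proj₁ (proj₂ first)
      stays-inside (suc k) = proj₂ (step-inside (step-from k))

      step-from : ∀ k → Step grafted (i₀ ∷ b′ k) (b (suc (suc k)))
      step-from k = subst (λ p → Step grafted p (b (suc (suc k)))) (stays-inside k) (proj₂ ib (suc k))

    sub-branch : InfBranch sub b′
    sub-branch = cong (drop 1) (proj₁ (proj₂ first)) , λ k → proj₁ (step-inside (step-from k))

    lift-at : ∀ k {T} → tree sub at b′ k ≡ just T → tree grafted at b (suc k) ≡ just T
    lift-at k {T} e =
      subst (λ p → tree grafted at p ≡ just T) (sym (stays-inside k)) (trans (at-≡ (b′ k)) e)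

    branch-good : GoodBranch grafted b
    branch-good with sub-trace b′ sub-branch
    ... | x , N , free , cases = x , suc N , free′ , cases′
      where
      free′ : ∀ i → suc N ≤ i → FreeAt grafted x (b i)
      free′ (suc i) (s≤s N≤i) = let T , a , x∈ = free i N≤i in T , lift-at i a , x∈
      cases′ : ∀ i → Σ ℕ λ j → (i ≤ j) × CaseAt grafted x (b j)
      cases′ i = let j , i≤j , s , cs , a = cases i
                 in suc j , ≤-trans i≤j (n≤1+n j) , s , cs , lift-at j a

  grafted-trace : GlobalTrace grafted
  grafted-trace = branch-good

preProofs : ∀ {ps} → All CHA⊢_ ps →
  Σ (List PreProof) λ Ps → (map label (map tree Ps) ≡ ps) × All GlobalTrace Ps
preProofs [] = [] , refl , []
preProofs (d ∷ ds) =
  let Ps , labels , traces = preProofs ds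
  in CHA⊢_.proof d ∷ Ps , cong₂ _∷_ (CHA⊢_.root d) labels , CHA⊢_.global d ∷ traces

R₀-closed : ∀ {ps S} → Cl R₀ ps S → All CHA⊢_ ps → CHA⊢ S
R₀-closed {S = S} r ds =
  let Ps , labels , traces = preProofs ds
      open Graft S Ps (subst (λ qs → Cl R₀ qs S) (sym labels) r) traces
  in record { proof = grafted ; root = refl ; global = grafted-trace }

module InductionAxiom (φ : Fm 1) (s : Tm 0) {S : Seq}
  (S≈ : S ≈S ((inst φ `0 ∷ `∀ (φ `→ substF fv (λ _ → `S (bv fz)) φ) ∷ []) ⇒ inst φ s)) where

  φ⟨_⟩ : Tm 0 → Fm 0
  φ⟨ t ⟩ = inst φ t

  φS : Fm 1
  φS = substF fv (λ _ → `S (bv fz)) φ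

  indStep : Fm 0
  indStep = `∀ (φ `→ φS)

  Γ₀ : List (Fm 0)
  Γ₀ = φ⟨ `0 ⟩ ∷ indStep ∷ []

  y : ℕ
  y = fresh (fvF φ)

  y∉φ : y ∉ fvF φ
  y∉φ = fresh-∉ (fvF φ)

  y∉Γ₀ : y ∉ fvΓ Γ₀
  y∉Γ₀ = y∉φ ∘ ++-⊆ (fvF-substF⊆ _ (λ _ → refl) φ)
                    (++-⊆ (++-⊆ id (fvF-substF⊆ _ (λ _ → refl) φ)) λ ())

  Sy : Tm 0
  Sy = `S (fv y)

  refl≐ : Tm 0 → Fm 0
  refl≐ t = t `= t

  -- The equation y = y keeps y free in C even when φ ignores its variable, as the trace condition requires.
  C : Seq
  C = (refl≐ (fv y) ∷ Γ₀) ⇒ φ⟨ fv y ⟩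

  Γₛ : List (Fm 0)
  Γₛ = refl≐ Sy ∷ Γ₀

  case-premise : ∀ t → subS [ t / y ] C ≡ ((refl≐ t ∷ Γ₀) ⇒ φ⟨ t ⟩)
  case-premise t =
    cong₂ _⇒_ (cong₂ _∷_ (cong₂ _`=_ ([/]-self t y) ([/]-self t y)) (map-⟦⟧-fresh t Γ₀ y∉Γ₀))
              (inst-⟦⟧-fresh φ t y∉φ)

  step-premise : inst (φ `→ φS) (fv y) ≡ (φ⟨ fv y ⟩ `→ φ⟨ Sy ⟩)
  step-premise = cong (φ⟨ fv y ⟩ `→_) (inst-inst φ (`S (bv fz)) (fv y))

  leaf : Seq → Tree
  leaf s = node s base []

  tWk tCutS tMP tStep tCase tCut tGen tUse tRoot : Tree
  tWk = node ((refl≐ (fv y) ∷ Γₛ) ⇒ φ⟨ fv y ⟩) base [ bud C ]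
  tCutS = node (Γₛ ⇒ φ⟨ fv y ⟩) base (leaf (Γₛ ⇒ refl≐ (fv y)) ∷ tWk ∷ [])
  tMP = node (((φ⟨ fv y ⟩ `→ φ⟨ Sy ⟩) ∷ Γₛ) ⇒ φ⟨ Sy ⟩) base
             (tCutS ∷ leaf ((φ⟨ Sy ⟩ ∷ Γₛ) ⇒ φ⟨ Sy ⟩) ∷ [])
  tStep = node (Γₛ ⇒ φ⟨ Sy ⟩) base [ tMP ]
  tCase = node C (caseK y) (leaf ((refl≐ `0 ∷ Γ₀) ⇒ φ⟨ `0 ⟩) ∷ tStep ∷ [])
  tCut = node (Γ₀ ⇒ φ⟨ fv y ⟩) base (leaf (Γ₀ ⇒ refl≐ (fv y)) ∷ tCase ∷ [])
  tGen = node (Γ₀ ⇒ `∀ φ) base [ tCut ]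
  tUse = node ((`∀ φ ∷ Γ₀) ⇒ φ⟨ s ⟩) base [ leaf ((φ⟨ s ⟩ ∷ Γ₀) ⇒ φ⟨ s ⟩) ]
  tRoot = node S base (tGen ∷ tUse ∷ [])

  axiom : ∀ {s} → R₀ [] s → ProofTree C (leaf s)
  axiom r = rule (exactly r) []

  ⊢Wk : ProofTree C tWk
  ⊢Wk = rule (_ , _ , wk (refl≐ (fv y) ∷ Γ₀) (refl≐ Sy) φ⟨ fv y ⟩ , Pointwise.refl ≈S-refl , swap-≈S)
             (bud≈ ≈S-refl ∷ [])

  ⊢CutS : ProofTree C tCutS
  ⊢CutS = rule (exactly (cut Γₛ (refl≐ (fv y)) φ⟨ fv y ⟩)) (axiom (=R Γₛ (fv y)) ∷ ⊢Wk ∷ [])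

  ⊢MP : ProofTree C tMP
  ⊢MP = rule (exactly (→L Γₛ φ⟨ fv y ⟩ φ⟨ Sy ⟩ φ⟨ Sy ⟩)) (⊢CutS ∷ axiom (ax Γₛ φ⟨ Sy ⟩) ∷ [])

  ⊢Step : ProofTree C tStep
  ⊢Step = rule (_ , _ , ∀L Γₛ (φ `→ φS) φ⟨ Sy ⟩ (fv y) ,
                ≡⇒≈S (cong (λ χ → (χ ∷ Γₛ) ⇒ φ⟨ Sy ⟩) (sym step-premise)) ∷ [] ,
                absorb-≈S (there (there (here refl))))
               (⊢MP ∷ [])

  ⊢Case : ProofTree C tCase
  ⊢Case = rule (_ , _ , case C ,
                ≡⇒≈S (sym (case-premise `0)) ∷ ≡⇒≈S (sym (case-premise Sy)) ∷ [] , ≈S-refl)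
               (rule (_ , _ , ax (refl≐ `0 ∷ indStep ∷ []) φ⟨ `0 ⟩ , [] , swap-≈S) [] ∷ ⊢Step ∷ [])

  ⊢Root : ProofTree C tRoot
  ⊢Root = rule (_ , _ , cut Γ₀ (`∀ φ) φ⟨ s ⟩ , Pointwise.refl ≈S-refl , S≈) (⊢Gen ∷ ⊢Use ∷ [])
    where
    ⊢Gen : ProofTree C tGen
    ⊢Gen = rule (exactly (∀R Γ₀ φ y y∉Γ₀ y∉φ))
                (rule (exactly (cut Γ₀ (refl≐ (fv y)) φ⟨ fv y ⟩))
                      (axiom (=R Γ₀ (fv y)) ∷ ⊢Case ∷ []) ∷ [])
    ⊢Use : ProofTree C tUse
    ⊢Use = rule (exactly (∀L Γ₀ φ φ⟨ s ⟩ s)) (axiom (ax Γ₀ φ⟨ s ⟩) ∷ [])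

  -- The nodes an infinite branch can pass through: every other node is a leaf or the parent of a leaf.
  data Live : Set where
    lRoot lGen lCut lCase lStep lMP lCutS lWk lBud : Live

  pos : Live → Pos
  pos lRoot = []
  pos lGen = 0 ∷ []
  pos lCut = 0 ∷ 0 ∷ []
  pos lCase = 0 ∷ 0 ∷ 1 ∷ []
  pos lStep = 0 ∷ 0 ∷ 1 ∷ 1 ∷ []
  pos lMP = 0 ∷ 0 ∷ 1 ∷ 1 ∷ 0 ∷ []
  pos lCutS = 0 ∷ 0 ∷ 1 ∷ 1 ∷ 0 ∷ 0 ∷ []
  pos lWk = 0 ∷ 0 ∷ 1 ∷ 1 ∷ 0 ∷ 0 ∷ 1 ∷ []
  pos lBud = 0 ∷ 0 ∷ 1 ∷ 1 ∷ 0 ∷ 0 ∷ 1 ∷ 0 ∷ []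

  next : Live → Live
  next lRoot = lGen
  next lGen = lCut
  next lCut = lCase
  next lCase = lStep
  next lStep = lMP
  next lMP = lCutS
  next lCutS = lWk
  next lWk = lBud
  next lBud = lCase

  cyclic : PreProof
  cyclic = singleCompanion tRoot (pos lCase) ⊢Root refl

  step-along : ∀ l {q} → Step cyclic (pos l) q → q ≡ pos (next l) ⊎ Stuck₂ cyclic q
  step-along lRoot (inj₁ (0 , refl , _)) = inj₁ refl
  step-along lRoot (inj₁ (1 , refl , _)) = inj₂ (unary-leaf-stuck₂ cyclic (pos lRoot ++ [ 1 ]) refl)
  step-along lRoot (inj₁ (suc (suc _) , refl , _ , ()))
  step-along lGen (inj₁ (0 , refl , _)) = inj₁ refl
  step-along lGen (inj₁ (suc _ , refl , _ , ()))
  step-along lCut (inj₁ (0 , refl , _)) = inj₂ (leaf-stuck₂ cyclic (pos lCut ++ [ 0 ]) refl)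
  step-along lCut (inj₁ (1 , refl , _)) = inj₁ refl
  step-along lCut (inj₁ (suc (suc _) , refl , _ , ()))
  step-along lCase (inj₁ (0 , refl , _)) = inj₂ (leaf-stuck₂ cyclic (pos lCase ++ [ 0 ]) refl)
  step-along lCase (inj₁ (1 , refl , _)) = inj₁ refl
  step-along lCase (inj₁ (suc (suc _) , refl , _ , ()))
  step-along lStep (inj₁ (0 , refl , _)) = inj₁ refl
  step-along lStep (inj₁ (suc _ , refl , _ , ()))
  step-along lMP (inj₁ (0 , refl , _)) = inj₁ refl
  step-along lMP (inj₁ (1 , refl , _)) = inj₂ (leaf-stuck₂ cyclic (pos lMP ++ [ 1 ]) refl)
  step-along lMP (inj₁ (suc (suc _) , refl , _ , ()))
  step-along lCutS (inj₁ (0 , refl , _)) = inj₂ (leaf-stuck₂ cyclic (pos lCutS ++ [ 0 ]) refl)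
  step-along lCutS (inj₁ (1 , refl , _)) = inj₁ refl
  step-along lCutS (inj₁ (suc (suc _) , refl , _ , ()))
  step-along lWk (inj₁ (0 , refl , _)) = inj₁ refl
  step-along lWk (inj₁ (suc _ , refl , _ , ()))
  step-along lBud (inj₁ (_ , refl , _ , ()))
  step-along lBud (inj₂ (_ , refl)) = inj₁ refl
  step-along lRoot (inj₂ ((_ , ()) , _))
  step-along lGen (inj₂ ((_ , ()) , _))
  step-along lCut (inj₂ ((_ , ()) , _))
  step-along lCase (inj₂ ((_ , ()) , _))
  step-along lStep (inj₂ ((_ , ()) , _))
  step-along lMP (inj₂ ((_ , ()) , _))
  step-along lCutS (inj₂ ((_ , ()) , _))
  step-along lWk (inj₂ ((_ , ()) , _))

  walk : ℕ → Live
  walk = fold lRoot next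

  branch-walks : ∀ b → InfBranch cyclic b → ∀ i → b i ≡ pos (walk i)
  branch-walks b (b0 , _) zero = b0
  branch-walks b ib@(_ , steps) (suc i)
    with step-along (walk i) (subst (λ p → Step cyclic p (b (suc i))) (branch-walks b ib i) (steps i))
  ... | inj₁ moved = moved
  ... | inj₂ stuck = ⊥-elim (stuck (steps (suc i)) (steps (suc (suc i))))

  -- y is free at every live node except lRoot, lGen and lCut, which a branch visits only at its start.
  y-free : ∀ l → FreeAt cyclic y (pos (next (next (next l))))
  y-free lRoot = _ , refl , here refl
  y-free lGen = _ , refl , here refl
  y-free lCut = _ , refl , ∈-++⁺ˡ (∈-++⁺ʳ (fvF (φ⟨ fv y ⟩ `→ φ⟨ Sy ⟩)) (here refl))
  y-free lCase = _ , refl , here refl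
  y-free lStep = _ , refl , here refl
  y-free lMP = _ , refl , here refl
  y-free lCutS = _ , refl , here refl
  y-free lWk = _ , refl , here refl
  y-free lBud = _ , refl , ∈-++⁺ˡ (∈-++⁺ʳ (fvF (φ⟨ fv y ⟩ `→ φ⟨ Sy ⟩)) (here refl))

  distance-to-case : Live → ℕ
  distance-to-case lRoot = 3
  distance-to-case lGen = 2
  distance-to-case lCut = 1
  distance-to-case lCase = 0
  distance-to-case lStep = 5
  distance-to-case lMP = 4
  distance-to-case lCutS = 3
  distance-to-case lWk = 2
  distance-to-case lBud = 1

  reaches-case : ∀ l → fold l next (distance-to-case l) ≡ lCase
  reaches-case lRoot = refl
  reaches-case lGen = refl
  reaches-case lCut = refl
  reaches-case lCase = refl
  reaches-case lStep = refl
  reaches-case lMP = refl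
  reaches-case lCutS = refl
  reaches-case lWk = refl
  reaches-case lBud = refl

  cyclic-trace : GlobalTrace cyclic
  cyclic-trace b ib = y , 3 , free , cases
    where
    free : ∀ i → 3 ≤ i → FreeAt cyclic y (b i)
    free _ (s≤s (s≤s (s≤s {n = i} _))) =
      subst (FreeAt cyclic y) (sym (branch-walks b ib (3 + i))) (y-free (walk i))

    cases : ∀ i → Σ ℕ λ j → (i ≤ j) × CaseAt cyclic y (b j)
    cases i = j , m≤n+m i _ ,
      subst (CaseAt cyclic y) (sym (trans (branch-walks b ib j) (cong pos at-case))) (C , _ , refl)
      where
      j : ℕ
      j = distance-to-case (walk i) + i
      at-case : walk j ≡ lCase
      at-case = trans (fold-+ lRoot next (distance-to-case (walk i))) (reaches-case (walk i))

  derivable : CHA⊢ S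
  derivable = record { proof = cyclic ; root = refl ; global = cyclic-trace }

mutual
  theorem2p7 : ∀ (S : Seq) → HA⊢ S → CHA⊢ S
  theorem2p7 S (by _ (_ , _ , inj₁ r , premises≈ , S≈) ds) =
    R₀-closed (_ , _ , r , premises≈ , S≈) (all-CHA ds)
  theorem2p7 S (by _ (_ , _ , inj₂ (ind φ t) , _ , S≈) _) = InductionAxiom.derivable φ t S≈

  all-CHA : ∀ {ps} → All HA⊢_ ps → All CHA⊢_ ps
  all-CHA [] = []
  all-CHA (d ∷ ds) = theorem2p7 _ d ∷ all-CHA ds
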